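{- Let $G$ be a graph, $v\in V(G)$, $p\ge 2$, and let $H$ be obtained from $G$ by $p$-stretching $v$ (new vertices $v_0,\dots,v_p$). Suppose $a^\top x\le\beta$ is a facet of $\mathrm{STAB}(G)$ with $a\in\mathbb{R}^{V(G)}$, $a\ge0$. For each $\ell\in[p]$ let $A_\ell=\Gamma_H(v_\ell)\setminus\{v_0\}$ and $d_\ell=a_v-\beta+\max\{a^\top x: x\in\mathrm{STAB}(G),\ x_i=0\ \forall i\in\{v\}\cup\bigcup_{j\in[p],j\ne\ell}A_j\}.$ If the inequality $\sum_{i\in V(G)\setminus\{v\}} a_i x_i+\sum_{\ell=1}^p d_\ell x_{v_\ell}+\Big(\big(\sum_{\ell=1}^p d_\ell\big)-a_v\Big)x_{v_0}\le\beta-a_v+\sum_{\ell=1}^p d_\ell$ is valid for $\mathrm{STAB}(H)$, then it is a facet of $\mathrm{STAB}(H)$.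
   Context: All graphs are finite, simple, undirected. $\mathrm{STAB}(G)\subseteq\mathbb{R}^{V(G)}$ is the convex hull of incidence vectors of stable sets (sets of pairwise nonadjacent vertices) of $G$. $\Gamma_H(u)$ denotes the set of neighbours of $u$ in $H$. Vertex stretching: given $G$, $v\in V(G)$, $p\ge2$ and nonempty proper subsets $A_1,\dots,A_p$ of $\Gamma_G(v)$ with $\bigcup_\ell A_\ell=\Gamma_G(v)$, the $p$-stretching of $v$ replaces $v$ by new vertices $v_0,\dots,v_p$ and joins, for each $\ell\in[p]$, $v_\ell$ to $v_0$ and to all vertices of $A_\ell$ (other edges of $G-v$ kept).
   Formalization: The facet coefficients $a$ and $\beta$ are rational instead of real, and the stable set polytopes, the maxima defining d_ℓ, validity and facets are taken over ℚ. -}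

module Defs where

open import Data.Nat as ℕ using (ℕ; zero; suc)
open import Data.Fin using (Fin; zero; suc; splitAt; punchIn)
open import Data.Bool using (Bool; true; false; if_then_else_)
open import Data.Sum using (_⊎_; inj₁; inj₂)
open import Data.Product using (Σ; _×_; _,_; ∃)
open import Data.Rational using (ℚ; 0ℚ; 1ℚ; _+_; _*_; _-_; _≤_)
open import Relation.Binary.PropositionalEquality using (_≡_; _≢_)
open import Relation.Nullary using (¬_)

Adj : ℕ → Set
Adj N = Fin N → Fin N → Bool

IsGraph : ∀ {N} → Adj N → Set
IsGraph {N} G = (∀ (i j : Fin N) → G i j ≡ G j i) × (∀ (i : Fin N) → G i i ≡ false)

Pt : ℕ → Set
Pt N = Fin N → ℚ

sumF : ∀ {k} → (Fin k → ℚ) → ℚ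
sumF {zero} f = 0ℚ
sumF {suc k} f = f zero + sumF (λ i → f (suc i))

dot : ∀ {N} → Pt N → Pt N → ℚ
dot a x = sumF (λ i → a i * x i)

Stable : ∀ {N} → Adj N → (Fin N → Bool) → Set
Stable {N} G S = ∀ (i j : Fin N) → S i ≡ true → S j ≡ true → G i j ≡ false

incidence : ∀ {N} → (Fin N → Bool) → Pt N
incidence S i = if S i then 1ℚ else 0ℚ

InSTAB : ∀ {N} → Adj N → Pt N → Set
InSTAB {N} G x =
  Σ ℕ λ k → Σ (Fin k → (Fin N → Bool)) λ S → Σ (Fin k → ℚ) λ w →
    (∀ t → Stable G (S t)) × (∀ t → 0ℚ ≤ w t) × (sumF w ≡ 1ℚ) ×
    (∀ i → x i ≡ sumF (λ t → w t * incidence (S t) i))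

AffInd : ∀ {N k} → (Fin k → Pt N) → Set
AffInd {N} {k} P =
  ∀ (c : Fin k → ℚ) → sumF c ≡ 0ℚ → (∀ (i : Fin N) → sumF (λ t → c t * P t i) ≡ 0ℚ) →
  ∀ t → c t ≡ 0ℚ

HasDim : ∀ {N} → (Pt N → Set) → ℕ → Set
HasDim {N} S d =
  (Σ (Fin (suc d) → Pt N) λ P → (∀ t → S (P t)) × AffInd P) ×
  ¬ (Σ (Fin (suc (suc d)) → Pt N) λ P → (∀ t → S (P t)) × AffInd P)

Valid : ∀ {N} → Adj N → Pt N → ℚ → Set
Valid G a β = ∀ x → InSTAB G x → dot a x ≤ β

Facet : ∀ {N} → Adj N → Pt N → ℚ → Set
Facet G a β =
  Valid G a β ×
  Σ ℕ λ d → HasDim (InSTAB G) (suc d) × HasDim (λ x → InSTAB G x × dot a x ≡ β) d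

IsMax : ∀ {N} → (Pt N → Set) → (Pt N → ℚ) → ℚ → Set
IsMax P f m = (Σ _ λ x → P x × f x ≡ m) × (∀ x → P x → f x ≤ m)

IsStretchFamily : ∀ {N p} → Adj N → Fin N → (Fin p → Fin N → Bool) → Set
IsStretchFamily {N} {p} G v A =
  (∀ (ℓ : Fin p) →
     (∀ u → A ℓ u ≡ true → G v u ≡ true) ×
     (∃ λ u → A ℓ u ≡ true) ×
     (∃ λ u → G v u ≡ true × A ℓ u ≡ false)) ×
  (∀ u → G v u ≡ true → ∃ λ (ℓ : Fin p) → A ℓ u ≡ true)

-- Vertices of H = stretched graph: Fin (n + suc p), split as
--   inj₁ a  : the old vertex punchIn v a of G - v   (a : Fin n)
--   inj₂ 0  : v₀
--   inj₂ (suc ℓ) : v_{ℓ+1}   (ℓ : Fin p)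
stretchAdj' : ∀ {n p} → Adj (suc n) → Fin (suc n) → (Fin p → Fin (suc n) → Bool) →
              Fin n ⊎ Fin (suc p) → Fin n ⊎ Fin (suc p) → Bool
stretchAdj' G v A (inj₁ a) (inj₁ b) = G (punchIn v a) (punchIn v b)
stretchAdj' G v A (inj₁ a) (inj₂ zero) = false
stretchAdj' G v A (inj₁ a) (inj₂ (suc ℓ)) = A ℓ (punchIn v a)
stretchAdj' G v A (inj₂ zero) (inj₁ b) = false
stretchAdj' G v A (inj₂ (suc ℓ)) (inj₁ b) = A ℓ (punchIn v b)
stretchAdj' G v A (inj₂ zero) (inj₂ zero) = false
stretchAdj' G v A (inj₂ zero) (inj₂ (suc _)) = true
stretchAdj' G v A (inj₂ (suc _)) (inj₂ zero) = true
stretchAdj' G v A (inj₂ (suc _)) (inj₂ (suc _)) = false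

stretch : ∀ {n p} → Adj (suc n) → Fin (suc n) → (Fin p → Fin (suc n) → Bool) →
          Adj (n ℕ.+ suc p)
stretch {n} G v A i j = stretchAdj' G v A (splitAt n i) (splitAt n j)

RestrictedSTAB : ∀ {n p} → Adj (suc n) → Fin (suc n) → (Fin p → Fin (suc n) → Bool) →
                 Fin p → Pt (suc n) → Set
RestrictedSTAB {n} {p} G v A ℓ x =
  InSTAB G x × x v ≡ 0ℚ × (∀ (j : Fin p) → j ≢ ℓ → ∀ i → A j i ≡ true → x i ≡ 0ℚ)

dCoef : ∀ {n p} → Pt (suc n) → ℚ → Fin (suc n) → (Fin p → ℚ) → Fin p → ℚ
dCoef a β v m ℓ = a v - β + m ℓ

liftCoef' : ∀ {n p} → Pt (suc n) → Fin (suc n) → (Fin p → ℚ) → Fin n ⊎ Fin (suc p) → ℚ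
liftCoef' a v d (inj₁ b) = a (punchIn v b)
liftCoef' a v d (inj₂ zero) = sumF d - a v
liftCoef' a v d (inj₂ (suc ℓ)) = d ℓ

liftCoef : ∀ {n p} → Pt (suc n) → Fin (suc n) → (Fin p → ℚ) → Pt (n ℕ.+ suc p)
liftCoef {n} a v d i = liftCoef' a v d (splitAt n i)

liftRhs : ∀ {n p} → Pt (suc n) → ℚ → Fin (suc n) → (Fin p → ℚ) → ℚ
liftRhs a β v d = β - a v + sumF d

-- Write |V(G)| = n + 1.  STAB(G) and STAB(H) are full-dimensional (the empty set and the singletons
-- are stable), so the facet aᵀx ≤ β contains n + 1 affinely independent points X_s of STAB(G), and
-- each maximiser Y_ℓ of the ℓ-th restricted problem is a point of STAB(G) as well.  Both kinds of
-- points are carried into STAB(H) by affine maps that send stable sets to stable sets: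
-- X_s keeps its old coordinates and gets x_{v₀} = 1 - x_v and x_{v_j} = x_v, while Y_ℓ gets
-- x_{v₀} = x_{v_ℓ} = 0 and x_{v_j} = 1 for j ≠ ℓ.  The lifted X_s satisfy the new inequality with
-- equality for any choice of d; the lifted Y_ℓ do so exactly because d_ℓ = a_v - β + m_ℓ.  In an
-- affine dependence among these n + 1 + p = |V(H)| points the coordinates v₀ and v_j force the
-- coefficients of the Y_ℓ to vanish, so the points are affinely independent.  Conversely, the new
-- normal vector is nonzero (otherwise a = 0, and aᵀx ≤ β would not define a proper face), and a
-- hyperplane of ℚ^N contains at most N affinely independent points, by Gaussian elimination.
module Submission where

open import Defs
open import Data.Nat using (ℕ; suc; _≤_)
open import Data.Fin using (Fin)
open import Data.Bool using (Bool)
open import Data.Rational using (ℚ; 0ℚ)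
open import Data.Rational as Q using ()

open import Algebra.Bundles using (CommutativeRing)
open import Data.Bool as Bool using (true; false; not; if_then_else_)
open import Data.Bool.Properties using (¬-not)
open import Data.Empty using (⊥-elim)
open import Data.Fin using (zero; suc; punchIn; punchOut; splitAt; join; _↑ˡ_; _↑ʳ_; _≟_)
open import Data.Fin.Properties
  using (punchInᵢ≢i; punchIn-punchOut; splitAt-↑ˡ; splitAt-↑ʳ; splitAt-join; join-splitAt;
         all?; any?; ¬∀⟶∃¬)
open import Data.Nat as ℕ using (zero; s≤s)
open import Data.Nat.Properties
  using (≮⇒≥; ≤-antisym; m≤n⇒m≤1+n; m≤n⇒∃[o]m+o≡n; +-suc; 1+n≰n; suc-injective)
open import Data.Product using (Σ; ∃; _×_; _,_; proj₁; proj₂)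
open import Data.Rational using (1ℚ; _+_; _*_; _-_; -_; 1/_)
open import Data.Rational.Properties
  using (+-*-commutativeRing; *-identityˡ; *-identityʳ; *-zeroˡ; *-zeroʳ; *-assoc; *-inverseˡ;
         +-identityˡ; +-identityʳ; +-assoc; nonNegative⁻¹)
open import Data.Sum using (_⊎_; inj₁; inj₂; [_,_])
open import Data.Vec.Functional using (_∷_; _++_; insertAt)
open import Data.Vec.Functional.Properties
  using (insertAt-lookup; insertAt-punchIn; lookup-++ˡ; lookup-++ʳ)
open import Function using (_∘_; mk⇔)
open import Level using (0ℓ)
open import Relation.Binary.PropositionalEquality
  using (_≡_; _≢_; refl; sym; trans; cong; cong₂; subst; module ≡-Reasoning)
open import Relation.Nullary using (¬_; Dec; yes; no; does; ¬?)
open import Relation.Nullary.Decidable using (_×-dec_; does-⇔; dec⇒maybe; dec-true; dec-false)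
open import Tactic.RingSolver using (solve-∀)
open import Tactic.RingSolver.Core.AlmostCommutativeRing
  using (AlmostCommutativeRing; fromCommutativeRing)

open import Algebra.Properties.Semiring.Sum (CommutativeRing.semiring +-*-commutativeRing)
  using (sum; sum-cong-≗; sum-replicate-zero; ∑-comm; sum-remove; *-distribˡ-sum; *-distribʳ-sum)

open ≡-Reasoning

ℚ-ring : AlmostCommutativeRing 0ℓ 0ℓ
ℚ-ring = fromCommutativeRing +-*-commutativeRing (λ x → dec⇒maybe (0ℚ Q.≟ x))

x≡y-[y-x] : ∀ x y → x ≡ y - (y - x)
x≡y-[y-x] = solve-∀ ℚ-ring

p*q≡0⇒q≡0 : ∀ {p q} → p ≢ 0ℚ → p * q ≡ 0ℚ → q ≡ 0ℚ
p*q≡0⇒q≡0 {p} {q} p≢0 pq≡0 = begin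
  q                ≡⟨ *-identityˡ q ⟨
  1ℚ * q           ≡⟨ cong (_* q) (*-inverseˡ p) ⟨
  (1/ p) * p * q   ≡⟨ *-assoc (1/ p) p q ⟩
  (1/ p) * (p * q) ≡⟨ cong ((1/ p) *_) pq≡0 ⟩
  (1/ p) * 0ℚ      ≡⟨ *-zeroʳ (1/ p) ⟩
  0ℚ               ∎
  where instance _ = Q.≢-nonZero p≢0

sumF≡sum : ∀ {k} (f : Fin k → ℚ) → sumF f ≡ sum f
sumF≡sum {zero}  f = refl
sumF≡sum {suc k} f = cong (f zero +_) (sumF≡sum (f ∘ suc))

sumF-cong : ∀ {k} {f g : Fin k → ℚ} → (∀ i → f i ≡ g i) → sumF f ≡ sumF g
sumF-cong {f = f} {g} f≗g = trans (sumF≡sum f) (trans (sum-cong-≗ f≗g) (sym (sumF≡sum g)))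

sumF-zero : ∀ {k} {f : Fin k → ℚ} → (∀ i → f i ≡ 0ℚ) → sumF f ≡ 0ℚ
sumF-zero {k} f≗0 = trans (sumF-cong f≗0) (trans (sumF≡sum {k} (λ _ → 0ℚ)) (sum-replicate-zero k))

*-distribˡ-sumF : ∀ {k} x (f : Fin k → ℚ) → sumF (λ i → x * f i) ≡ x * sumF f
*-distribˡ-sumF x f = trans (sumF≡sum (λ i → x * f i))
  (trans (sym (*-distribˡ-sum x f)) (cong (x *_) (sym (sumF≡sum f))))

*-distribʳ-sumF : ∀ {k} x (f : Fin k → ℚ) → sumF (λ i → f i * x) ≡ sumF f * x
*-distribʳ-sumF x f = trans (sumF≡sum (λ i → f i * x))
  (trans (sym (*-distribʳ-sum x f)) (cong (_* x) (sym (sumF≡sum f))))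

sumF-comm : ∀ {k l} (f : Fin k → Fin l → ℚ) →
            sumF (λ t → sumF (f t)) ≡ sumF (λ i → sumF (λ t → f t i))
sumF-comm f = begin
  sumF (λ t → sumF (f t))         ≡⟨ sumF-cong (λ t → sumF≡sum (f t)) ⟩
  sumF (λ t → sum (f t))          ≡⟨ sumF≡sum (λ t → sum (f t)) ⟩
  sum (λ t → sum (f t))           ≡⟨ ∑-comm f ⟩
  sum (λ i → sum (λ t → f t i))   ≡⟨ sumF≡sum (λ i → sum (λ t → f t i)) ⟨
  sumF (λ i → sum (λ t → f t i))  ≡⟨ sumF-cong (λ i → sumF≡sum (λ t → f t i)) ⟨
  sumF (λ i → sumF (λ t → f t i)) ∎

sumF-remove : ∀ {k} (f : Fin (suc k) → ℚ) i → sumF f ≡ f i + sumF (f ∘ punchIn i)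
sumF-remove f i = trans (sumF≡sum f)
  (trans (sum-remove f) (cong (f i +_) (sym (sumF≡sum (f ∘ punchIn i)))))

sumF-split : ∀ m {n} (f : Fin (m ℕ.+ n) → ℚ) →
             sumF f ≡ sumF (λ i → f (i ↑ˡ n)) + sumF (λ j → f (m ↑ʳ j))
sumF-split zero    f = sym (+-identityˡ _)
sumF-split (suc m) f =
  trans (cong (f zero +_) (sumF-split m (f ∘ suc))) (sym (+-assoc (f zero) _ _))

sumF-distrib-- : ∀ {k} (f g : Fin k → ℚ) → sumF (λ i → f i - g i) ≡ sumF f - sumF g
sumF-distrib-- {zero}  f g = refl
sumF-distrib-- {suc k} f g =
  trans (cong (f zero - g zero +_) (sumF-distrib-- (f ∘ suc) (g ∘ suc))) (shuffle (f zero) (g zero) _ _)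
  where
  shuffle : ∀ a b c d → (a - b) + (c - d) ≡ (a + c) - (b + d)
  shuffle = solve-∀ ℚ-ring

lincomb : ∀ {k} {I : Set} → (Fin k → ℚ) → (Fin k → I → ℚ) → I → ℚ
lincomb c P i = sumF (λ t → c t * P t i)

LinearlyDependent : ∀ {k} {I : Set} → (Fin k → I → ℚ) → Set
LinearlyDependent {k} P =
  Σ (Fin k → ℚ) λ c → (∀ i → lincomb c P i ≡ 0ℚ) × ∃ λ t → c t ≢ 0ℚ

linearlyDependent-tail : ∀ {M k} (P : Fin k → Pt (suc M)) → (∀ t → P t zero ≡ 0ℚ) →
                         LinearlyDependent (λ t → P t ∘ suc) → LinearlyDependent P
linearlyDependent-tail P head≡0 (c , c-tail , c≢0) = c , c-coord , c≢0
  where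
  c-coord : ∀ i → lincomb c P i ≡ 0ℚ
  c-coord zero    = sumF-zero (λ t → trans (cong (c t *_) (head≡0 t)) (*-zeroʳ (c t)))
  c-coord (suc i) = c-tail i

eliminate : ∀ {M k} → Fin (suc k) → (Fin (suc k) → Pt (suc M)) → Fin k → Pt M
eliminate t₀ P s i = P t₀ zero * P (punchIn t₀ s) (suc i) - P t₀ (suc i) * P (punchIn t₀ s) zero

linearlyDependent-pivot : ∀ {M k} (P : Fin (suc k) → Pt (suc M)) t₀ → P t₀ zero ≢ 0ℚ →
                          LinearlyDependent (eliminate t₀ P) → LinearlyDependent P
linearlyDependent-pivot {k = k} P t₀ α≢0 (c′ , c′-coord , s₀ , c′≢0) =
  c , c-coord , punchIn t₀ s₀ , c≢0
  where
  α Y : ℚ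
  α = P t₀ zero
  Y = lincomb c′ (P ∘ punchIn t₀) zero
  c : Fin (suc k) → ℚ
  c = insertAt (λ s → α * c′ s) t₀ (- Y)
  expand : ∀ i → lincomb c P i ≡ - Y * P t₀ i + α * lincomb c′ (P ∘ punchIn t₀) i
  expand i = begin
    lincomb c P i
      ≡⟨ sumF-remove (λ t → c t * P t i) t₀ ⟩
    c t₀ * P t₀ i + sumF (λ s → c (punchIn t₀ s) * P (punchIn t₀ s) i)
      ≡⟨ cong₂ _+_ (cong (_* P t₀ i) (insertAt-lookup _ t₀ (- Y)))
                   (sumF-cong (λ s → cong (_* P (punchIn t₀ s) i) (insertAt-punchIn _ t₀ (- Y) s))) ⟩
    - Y * P t₀ i + sumF (λ s → α * c′ s * P (punchIn t₀ s) i)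
      ≡⟨ cong (- Y * P t₀ i +_) (trans (sumF-cong (λ s → *-assoc α (c′ s) _))
                                       (*-distribˡ-sumF α (λ s → c′ s * P (punchIn t₀ s) i))) ⟩
    - Y * P t₀ i + α * lincomb c′ (P ∘ punchIn t₀) i
      ∎
  c-coord : ∀ i → lincomb c P i ≡ 0ℚ
  c-coord zero = trans (expand zero) (cancel Y α)
    where
    cancel : ∀ y a → - y * a + a * y ≡ 0ℚ
    cancel = solve-∀ ℚ-ring
  c-coord (suc i) = begin
    lincomb c P (suc i)                          ≡⟨ expand (suc i) ⟩
    - Y * e + α * sumF x
      ≡⟨ swap Y e α (sumF x) ⟩
    α * sumF x - e * Y
      ≡⟨ cong₂ _-_ (*-distribˡ-sumF α x) (*-distribˡ-sumF e y) ⟨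
    sumF (λ s → α * x s) - sumF (λ s → e * y s)
      ≡⟨ sumF-distrib-- (λ s → α * x s) (λ s → e * y s) ⟨
    sumF (λ s → α * x s - e * y s)
      ≡⟨ sumF-cong (λ s → factor (c′ s) α e _ _) ⟩
    lincomb c′ (eliminate t₀ P) i
      ≡⟨ c′-coord i ⟩
    0ℚ
      ∎
    where
    e : ℚ
    e = P t₀ (suc i)
    x y : Fin k → ℚ
    x s = c′ s * P (punchIn t₀ s) (suc i)
    y s = c′ s * P (punchIn t₀ s) zero
    swap : ∀ Y e α L → - Y * e + α * L ≡ α * L - e * Y
    swap = solve-∀ ℚ-ring
    factor : ∀ c α e p q → α * (c * p) - e * (c * q) ≡ c * (α * p - e * q)
    factor = solve-∀ ℚ-ring
  c≢0 : c (punchIn t₀ s₀) ≢ 0ℚ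
  c≢0 c≡0 = c′≢0 (p*q≡0⇒q≡0 α≢0 (trans (sym (insertAt-punchIn _ t₀ (- Y) s₀)) c≡0))

<⇒linearlyDependent : ∀ {M k} → M ℕ.< k → (P : Fin k → Pt M) → LinearlyDependent P
<⇒linearlyDependent {zero}  {suc k} _ P = (λ _ → 1ℚ) , (λ ()) , zero , λ ()
<⇒linearlyDependent {suc M} {suc k} (s≤s M<k) P with all? (λ t → P t zero Q.≟ 0ℚ)
... | yes head≡0 =
  linearlyDependent-tail P head≡0 (<⇒linearlyDependent (m≤n⇒m≤1+n M<k) (λ t → P t ∘ suc))
... | no ¬head≡0 with t₀ , α≢0 ← ¬∀⟶∃¬ _ _ (λ t → P t zero Q.≟ 0ℚ) ¬head≡0 =
  linearlyDependent-pivot P t₀ α≢0 (<⇒linearlyDependent M<k (eliminate t₀ P))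

AffIndIn : ∀ {N} → (Pt N → Set) → ℕ → Set
AffIndIn {N} S k = Σ (Fin k → Pt N) λ P → (∀ t → S (P t)) × AffInd P

AffInd⇒≤ : ∀ {N k} (P : Fin k → Pt N) → AffInd P → k ≤ suc N
AffInd⇒≤ P P-aff = ≮⇒≥ λ N+1<k → independent (<⇒linearlyDependent N+1<k (λ t → 1ℚ ∷ P t))
  where
  independent : ¬ LinearlyDependent (λ t → 1ℚ ∷ P t)
  independent (c , c-coord , t , c≢0) =
    c≢0 (P-aff c (trans (sumF-cong (λ t → sym (*-identityʳ (c t)))) (c-coord zero)) (c-coord ∘ suc) t)

AffInd-↑ˡ : ∀ {N j o} {P : Fin (j ℕ.+ o) → Pt N} → AffInd P → AffInd (λ t → P (t ↑ˡ o))
AffInd-↑ˡ {N} {j} {o} {P} P-aff c Σc≡0 c-coord t =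
  trans (sym (lookup-++ˡ c 0s t))
        (P-aff c⁺ Σc⁺≡0 (λ i → trans (padded (λ t → P t i)) (c-coord i)) (t ↑ˡ o))
  where
  0s : Fin o → ℚ
  0s _ = 0ℚ
  c⁺ : Fin (j ℕ.+ o) → ℚ
  c⁺ = c ++ 0s
  padded : ∀ g → sumF (λ t → c⁺ t * g t) ≡ sumF (λ t → c t * g (t ↑ˡ o))
  padded g = begin
    sumF (λ t → c⁺ t * g t)
      ≡⟨ sumF-split j _ ⟩
    sumF (λ t → c⁺ (t ↑ˡ o) * g (t ↑ˡ o)) + sumF (λ s → c⁺ (j ↑ʳ s) * g (j ↑ʳ s))
      ≡⟨ cong₂ _+_ (sumF-cong (λ t → cong (_* g (t ↑ˡ o)) (lookup-++ˡ c 0s t)))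
                   (sumF-zero (λ s → trans (cong (_* g (j ↑ʳ s)) (lookup-++ʳ c 0s s))
                                           (*-zeroˡ (g (j ↑ʳ s))))) ⟩
    sumF (λ t → c t * g (t ↑ˡ o)) + 0ℚ
      ≡⟨ +-identityʳ _ ⟩
    sumF (λ t → c t * g (t ↑ˡ o))
      ∎
  Σc⁺≡0 : sumF c⁺ ≡ 0ℚ
  Σc⁺≡0 = begin
    sumF c⁺                ≡⟨ sumF-cong (λ t → *-identityʳ (c⁺ t)) ⟨
    sumF (λ t → c⁺ t * 1ℚ) ≡⟨ padded (λ _ → 1ℚ) ⟩
    sumF (λ t → c t * 1ℚ)  ≡⟨ sumF-cong (λ t → *-identityʳ (c t)) ⟩
    sumF c                 ≡⟨ Σc≡0 ⟩
    0ℚ                     ∎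

AffIndIn-shrink : ∀ {N j k} {S : Pt N → Set} → j ≤ k → AffIndIn S k → AffIndIn S j
AffIndIn-shrink j≤k (P , P∈S , P-aff) with o , refl ← m≤n⇒∃[o]m+o≡n j≤k =
  (λ t → P (t ↑ˡ o)) , (λ t → P∈S (t ↑ˡ o)) , AffInd-↑ˡ P-aff

HasDim-unique : ∀ {N d e} {S : Pt N → Set} → HasDim S d → HasDim S e → d ≡ e
HasDim-unique {S = S} (pts-d , ¬pts-d) (pts-e , ¬pts-e) =
  ≤-antisym (dim≤ pts-d ¬pts-e) (dim≤ pts-e ¬pts-d)
  where
  dim≤ : ∀ {d e} → AffIndIn S (suc d) → ¬ AffIndIn S (suc (suc e)) → d ≤ e
  dim≤ pts ¬pts = ≮⇒≥ λ e<d → ¬pts (AffIndIn-shrink {S = S} (s≤s e<d) pts)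

AffInd-++ : ∀ {N k l} {P : Fin k → Pt N} {Q : Fin l → Pt N} → AffInd P →
            (∀ c e → sumF c + sumF e ≡ 0ℚ → (∀ i → lincomb c P i + lincomb e Q i ≡ 0ℚ) →
                     ∀ s → e s ≡ 0ℚ) →
            AffInd (P ++ Q)
AffInd-++ {k = k} {l} {P} {Q} P-aff Q-part≡0 c Σc≡0 c-coord t =
  subst (λ t → c t ≡ 0ℚ) (join-splitAt k l t)
        ([_,_] {C = λ α → c (join k l α) ≡ 0ℚ} cᴾ≡0 cᵠ≡0 (splitAt k t))
  where
  cᴾ : Fin k → ℚ
  cᴾ s = c (s ↑ˡ l)
  cᵠ : Fin l → ℚ
  cᵠ s = c (k ↑ʳ s)
  split-coord : ∀ i → lincomb c (P ++ Q) i ≡ lincomb cᴾ P i + lincomb cᵠ Q i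
  split-coord i = trans (sumF-split k (λ t → c t * (P ++ Q) t i))
    (cong₂ _+_ (sumF-cong (λ s → cong (λ R → cᴾ s * R i) (lookup-++ˡ P Q s)))
               (sumF-cong (λ s → cong (λ R → cᵠ s * R i) (lookup-++ʳ P Q s))))
  Σ-split : sumF cᴾ + sumF cᵠ ≡ 0ℚ
  Σ-split = trans (sym (sumF-split k c)) Σc≡0
  cᵠ≡0 : ∀ s → cᵠ s ≡ 0ℚ
  cᵠ≡0 = Q-part≡0 cᴾ cᵠ Σ-split (λ i → trans (sym (split-coord i)) (c-coord i))
  drop-0 : ∀ {x y} → y ≡ 0ℚ → x + y ≡ 0ℚ → x ≡ 0ℚ
  drop-0 {x} refl x+0≡0 = trans (sym (+-identityʳ x)) x+0≡0
  cᴾ≡0 : ∀ s → cᴾ s ≡ 0ℚ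
  cᴾ≡0 = P-aff cᴾ (drop-0 (sumF-zero cᵠ≡0) Σ-split) λ i →
    drop-0 (sumF-zero (λ s → trans (cong (_* Q s i) (cᵠ≡0 s)) (*-zeroˡ (Q s i))))
           (trans (sym (split-coord i)) (c-coord i))

dot-lincomb : ∀ {N k} (a : Pt N) (c : Fin k → ℚ) (P : Fin k → Pt N) →
              dot a (lincomb c P) ≡ sumF (λ t → c t * dot a (P t))
dot-lincomb a c P = begin
  sumF (λ i → a i * sumF (λ t → c t * P t i))
    ≡⟨ sumF-cong (λ i → *-distribˡ-sumF (a i) (λ t → c t * P t i)) ⟨
  sumF (λ i → sumF (λ t → a i * (c t * P t i)))
    ≡⟨ sumF-comm (λ t i → a i * (c t * P t i)) ⟨
  sumF (λ t → sumF (λ i → a i * (c t * P t i)))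
    ≡⟨ sumF-cong (λ t → sumF-cong (λ i → swap (a i) (c t) (P t i))) ⟩
  sumF (λ t → sumF (λ i → c t * (a i * P t i)))
    ≡⟨ sumF-cong (λ t → *-distribˡ-sumF (c t) (λ i → a i * P t i)) ⟩
  sumF (λ t → c t * dot a (P t))
    ∎
  where
  swap : ∀ a c x → a * (c * x) ≡ c * (a * x)
  swap = solve-∀ ℚ-ring

∀-punchIn : ∀ {n} {P : Fin (suc n) → Set} i → P i → (∀ j → P (punchIn i j)) → ∀ j → P j
∀-punchIn {P = P} i Pi P-punchIn j with i ≟ j
... | yes refl = Pi
... | no i≢j   = subst P (punchIn-punchOut i≢j) (P-punchIn (punchOut i≢j))

AffInd-dropCoordinate : ∀ {N k} {P : Fin k → Pt (suc N)} {c : Pt (suc N)} {r} i → c i ≢ 0ℚ →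
                        (∀ t → dot c (P t) ≡ r) → AffInd P → AffInd (λ t → P t ∘ punchIn i)
AffInd-dropCoordinate {N} {P = P} {c} {r} i cᵢ≢0 on-hyperplane P-aff μ Σμ≡0 μ-coord =
  P-aff μ Σμ≡0 (∀-punchIn i μ-coordᵢ μ-coord)
  where
  S : Pt (suc N)
  S = lincomb μ P
  others≡0 : sumF (λ j → c (punchIn i j) * S (punchIn i j)) ≡ 0ℚ
  others≡0 = sumF-zero (λ j → trans (cong (c (punchIn i j) *_) (μ-coord j)) (*-zeroʳ (c (punchIn i j))))
  μ-coordᵢ : S i ≡ 0ℚ
  μ-coordᵢ = p*q≡0⇒q≡0 cᵢ≢0 (begin
    c i * S i
      ≡⟨ +-identityʳ _ ⟨
    c i * S i + 0ℚ
      ≡⟨ cong (c i * S i +_) others≡0 ⟨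
    c i * S i + sumF (λ j → c (punchIn i j) * S (punchIn i j))
      ≡⟨ sumF-remove (λ j → c j * S j) i ⟨
    dot c S
      ≡⟨ dot-lincomb c μ P ⟩
    sumF (λ t → μ t * dot c (P t))
      ≡⟨ sumF-cong (λ t → cong (μ t *_) (on-hyperplane t)) ⟩
    sumF (λ t → μ t * r)
      ≡⟨ *-distribʳ-sumF r μ ⟩
    sumF μ * r
      ≡⟨ cong (_* r) Σμ≡0 ⟩
    0ℚ * r
      ≡⟨ *-zeroˡ r ⟩
    0ℚ
      ∎)

AffInd-hyperplane⇒≤ : ∀ {N k} {P : Fin k → Pt N} {c : Pt N} {r} → ¬ (∀ i → c i ≡ 0ℚ) →
                      (∀ t → dot c (P t) ≡ r) → AffInd P → k ≤ N
AffInd-hyperplane⇒≤ {zero}  c≢0 _ _ = ⊥-elim (c≢0 λ ())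
AffInd-hyperplane⇒≤ {suc N} {c = c} c≢0 on-hyperplane P-aff
  with i , cᵢ≢0 ← ¬∀⟶∃¬ _ _ (λ i → c i Q.≟ 0ℚ) c≢0 =
  AffInd⇒≤ _ (AffInd-dropCoordinate {c = c} i cᵢ≢0 on-hyperplane P-aff)

lowerDimFace⇒normal≢0 : ∀ {N d} {S : Pt N → Set} {a : Pt N} {β} →
                        HasDim S (suc d) → HasDim (λ x → S x × dot a x ≡ β) d →
                        ¬ (∀ i → a i ≡ 0ℚ)
lowerDimFace⇒normal≢0 {a = a} {β} ((P , P∈S , P-aff) , _) ((Q , Q∈F , _) , ¬face) a≡0 =
  ¬face (P , (λ t → P∈S t , trans (dot≡0 (P t)) (sym β≡0)) , P-aff)
  where
  dot≡0 : ∀ x → dot a x ≡ 0ℚ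
  dot≡0 x = sumF-zero (λ i → trans (cong (_* x i) (a≡0 i)) (*-zeroˡ (x i)))
  β≡0 : β ≡ 0ℚ
  β≡0 = trans (sym (proj₂ (Q∈F zero))) (dot≡0 (Q zero))

does-true : ∀ {P : Set} (P? : Dec P) → does P? ≡ true → P
does-true (yes p) _ = p

does-≟-comm : ∀ {k} (i j : Fin k) → does (i ≟ j) ≡ does (j ≟ i)
does-≟-comm i j = does-⇔ (mk⇔ sym sym) (i ≟ j) (j ≟ i)

bit : Bool → ℚ
bit b = if b then 1ℚ else 0ℚ

bit-not : ∀ b → bit (not b) ≡ 1ℚ - bit b
bit-not true  = refl
bit-not false = refl

sumF-δ : ∀ {k} (f : Fin k → ℚ) i → sumF (λ j → f j * bit (does (j ≟ i))) ≡ f i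
sumF-δ {suc k} f i = begin
  sumF (λ j → f j * bit (does (j ≟ i)))
    ≡⟨ sumF-remove (λ j → f j * bit (does (j ≟ i))) i ⟩
  f i * bit (does (i ≟ i)) + sumF (λ s → f (punchIn i s) * bit (does (punchIn i s ≟ i)))
    ≡⟨ cong₂ _+_ (cong (λ b → f i * bit b) (dec-true (i ≟ i) refl)) (sumF-zero off-diagonal) ⟩
  f i * 1ℚ + 0ℚ
    ≡⟨ trans (+-identityʳ _) (*-identityʳ (f i)) ⟩
  f i
    ∎
  where
  off-diagonal : ∀ s → f (punchIn i s) * bit (does (punchIn i s ≟ i)) ≡ 0ℚ
  off-diagonal s =
    trans (cong (λ b → f (punchIn i s) * bit b) (dec-false (punchIn i s ≟ i) (punchInᵢ≢i i s)))
          (*-zeroʳ (f (punchIn i s)))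

sumF-allBut : ∀ {k} (f : Fin k → ℚ) i → sumF (λ j → f j * bit (not (does (j ≟ i)))) ≡ sumF f - f i
sumF-allBut f i = begin
  sumF (λ j → f j * bit (not (does (j ≟ i))))
    ≡⟨ sumF-cong (λ j → trans (cong (f j *_) (bit-not (does (j ≟ i)))) (distrib (f j) _)) ⟩
  sumF (λ j → f j - f j * bit (does (j ≟ i)))
    ≡⟨ sumF-distrib-- f (λ j → f j * bit (does (j ≟ i))) ⟩
  sumF f - sumF (λ j → f j * bit (does (j ≟ i)))
    ≡⟨ cong (λ s → sumF f - s) (sumF-δ f i) ⟩
  sumF f - f i
    ∎
  where
  distrib : ∀ x b → x * (1ℚ - b) ≡ x - x * b
  distrib = solve-∀ ℚ-ring

incidence-InSTAB : ∀ {N} {G : Adj N} {S} → Stable G S → InSTAB G (incidence S)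
incidence-InSTAB {S = S} S-stable =
  1 , (λ _ → S) , (λ _ → 1ℚ) , (λ _ → S-stable) , (λ _ → nonNegative⁻¹ 1ℚ) , refl ,
  λ i → sym (trans (+-identityʳ _) (*-identityˡ _))

singleton : ∀ {N} → Fin N → Fin N → Bool
singleton j i = does (j ≟ i)

singleton-stable : ∀ {N} {G : Adj N} → (∀ i → G i i ≡ false) → ∀ j → Stable G (singleton j)
singleton-stable loopless j i i′ j≡i j≡i′
  with refl ← does-true (j ≟ i) j≡i | refl ← does-true (j ≟ i′) j≡i′ = loopless j

STAB-fullDim : ∀ {N} {G : Adj N} → (∀ i → G i i ≡ false) → HasDim (InSTAB G) N
STAB-fullDim {N} {G} loopless = (P , P∈STAB , P-aff) , λ (Q , _ , Q-aff) → 1+n≰n (AffInd⇒≤ Q Q-aff)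
  where
  P : Fin (suc N) → Pt N
  P zero    = incidence (λ _ → false)
  P (suc j) = incidence (singleton j)
  P∈STAB : ∀ t → InSTAB G (P t)
  P∈STAB zero    = incidence-InSTAB {S = λ _ → false} (λ _ _ ())
  P∈STAB (suc j) = incidence-InSTAB (singleton-stable loopless j)
  P-aff : AffInd P
  P-aff c Σc≡0 c-coord = c≡0
    where
    c≡0 : ∀ t → c t ≡ 0ℚ
    c≡0 (suc j) = begin
      c (suc j)                                       ≡⟨ sumF-δ (c ∘ suc) j ⟨
      sumF (λ j′ → c (suc j′) * P (suc j′) j)         ≡⟨ +-identityˡ _ ⟨
      0ℚ + sumF (λ j′ → c (suc j′) * P (suc j′) j)
        ≡⟨ cong (_+ sumF (λ j′ → c (suc j′) * P (suc j′) j)) (*-zeroʳ (c zero)) ⟨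
      lincomb c P j                                   ≡⟨ c-coord j ⟩
      0ℚ                                              ∎
    c≡0 zero = begin
      c zero       ≡⟨ +-identityʳ (c zero) ⟨
      c zero + 0ℚ  ≡⟨ cong (c zero +_) (sumF-zero (c≡0 ∘ suc)) ⟨
      sumF c       ≡⟨ Σc≡0 ⟩
      0ℚ           ∎

data Literal (N : ℕ) : Set where
  pos neg : Fin N → Literal N
  const   : Bool → Literal N

evalᵇ : ∀ {N} → Literal N → (Fin N → Bool) → Bool
evalᵇ (pos u)   S = S u
evalᵇ (neg u)   S = not (S u)
evalᵇ (const b) S = b

evalℚ : ∀ {N} → Literal N → Pt N → ℚ
evalℚ (pos u)   x = x u
evalℚ (neg u)   x = 1ℚ - x u
evalℚ (const b) x = bit b

-- evalℚ l is the affine extension of evalᵇ l, so it commutes with convex combinations.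
InSTAB-subst : ∀ {M N} {G : Adj N} {H : Adj M} (σ : Fin M → Literal N) →
               (∀ S → Stable G S → Stable H (λ i → evalᵇ (σ i) S)) →
               ∀ {x} → InSTAB G x → InSTAB H (λ i → evalℚ (σ i) x)
InSTAB-subst σ σ-stable {x} (k , S , w , S-stable , w≥0 , Σw≡1 , x≡) =
  k , (λ t i → evalᵇ (σ i) (S t)) , w , (λ t → σ-stable (S t) (S-stable t)) , w≥0 , Σw≡1 ,
  λ i → convex (σ i)
  where
  convex : ∀ l → evalℚ l x ≡ sumF (λ t → w t * bit (evalᵇ l (S t)))
  convex (pos u)   = x≡ u
  convex (neg u)   = sym (begin
    sumF (λ t → w t * bit (not (S t u)))    ≡⟨ sumF-cong (λ t → cong (w t *_) (bit-not (S t u))) ⟩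
    sumF (λ t → w t * (1ℚ - bit (S t u)))   ≡⟨ sumF-cong (λ t → distrib (w t) (bit (S t u))) ⟩
    sumF (λ t → w t - w t * bit (S t u))    ≡⟨ sumF-distrib-- w (λ t → w t * bit (S t u)) ⟩
    sumF w - sumF (λ t → w t * bit (S t u)) ≡⟨ cong₂ _-_ Σw≡1 (sym (x≡ u)) ⟩
    1ℚ - x u                                ∎)
    where
    distrib : ∀ w b → w * (1ℚ - b) ≡ w - w * b
    distrib = solve-∀ ℚ-ring
  convex (const b) =
    sym (trans (*-distribʳ-sumF (bit b) w) (trans (cong (_* bit b) Σw≡1) (*-identityˡ (bit b))))

Face : ∀ {N} → Adj N → Pt N → ℚ → Pt N → Set
Face G a β x = InSTAB G x × dot a x ≡ β

module Stretching {n p : ℕ} (G : Adj (suc n)) (v : Fin (suc n)) (A : Fin p → Fin (suc n) → Bool) where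

  H : Adj (n ℕ.+ suc p)
  H = stretch G v A

  Vertex : Set
  Vertex = Fin n ⊎ Fin (suc p)

  ι : Fin n → Fin (suc n)
  ι = punchIn v

  onH : (Vertex → ℚ) → Pt (n ℕ.+ suc p)
  onH y = y ∘ splitAt n

  ∀-Vertex : ∀ {F : Vertex → Set} → (∀ i → F (splitAt n i)) → ∀ α → F α
  ∀-Vertex {F} F-split α = subst F (splitAt-join n (suc p) α) (F-split (join n (suc p) α))

  Stable-H : ∀ {T : Vertex → Bool} →
             (∀ α γ → T α ≡ true → T γ ≡ true → stretchAdj' G v A α γ ≡ false) →
             Stable H (T ∘ splitAt n)
  Stable-H T-stable i j = T-stable (splitAt n i) (splitAt n j)

  H-loopless : (∀ u → G u u ≡ false) → ∀ i → H i i ≡ false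
  H-loopless G-loopless i = loopless (splitAt n i)
    where
    loopless : ∀ α → stretchAdj' G v A α α ≡ false
    loopless (inj₁ b)       = G-loopless (ι b)
    loopless (inj₂ zero)    = refl
    loopless (inj₂ (suc ℓ)) = refl

  dot-punchIn : ∀ (a x : Pt (suc n)) → dot a x ≡ a v * x v + sumF (λ b → a (ι b) * x (ι b))
  dot-punchIn a x = sumF-remove (λ u → a u * x u) v

  dot-liftCoef : ∀ a d (y : Vertex → ℚ) →
                 dot (liftCoef a v d) (onH y) ≡
                 sumF (λ b → a (ι b) * y (inj₁ b)) +
                 ((sumF d - a v) * y (inj₂ zero) + sumF (λ ℓ → d ℓ * y (inj₂ (suc ℓ))))
  dot-liftCoef a d y = trans (sumF-split n _)
    (cong₂ _+_ (sumF-cong (λ b → cong F (splitAt-↑ˡ n b (suc p))))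
               (sumF-cong (λ j → cong F (splitAt-↑ʳ n (suc p) j))))
    where
    F : Vertex → ℚ
    F α = liftCoef' a v d α * y α

  liftCoef≡0 : ∀ a d → (∀ i → liftCoef a v d i ≡ 0ℚ) → ∀ u → a u ≡ 0ℚ
  liftCoef≡0 a d coef≡0 = ∀-punchIn v aᵥ≡0 (λ b → lifted≡0 (inj₁ b))
    where
    lifted≡0 : ∀ α → liftCoef' a v d α ≡ 0ℚ
    lifted≡0 = ∀-Vertex coef≡0
    aᵥ≡0 : a v ≡ 0ℚ
    aᵥ≡0 = begin
      a v
        ≡⟨ x≡y-[y-x] (a v) (sumF d) ⟩
      sumF d - (sumF d - a v)
        ≡⟨ cong₂ _-_ (sumF-zero (lifted≡0 ∘ inj₂ ∘ suc)) (lifted≡0 (inj₂ zero)) ⟩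
      0ℚ - 0ℚ
        ≡⟨⟩
      0ℚ
        ∎

  faceLiteral : Vertex → Literal (suc n)
  faceLiteral (inj₁ b)       = pos (ι b)
  faceLiteral (inj₂ zero)    = neg v
  faceLiteral (inj₂ (suc ℓ)) = pos v

  faceLift : Pt (suc n) → Vertex → ℚ
  faceLift x α = evalℚ (faceLiteral α) x

  faceLift-stable : (∀ ℓ u → A ℓ u ≡ true → G v u ≡ true) →
                    ∀ S → Stable G S → Stable H (λ i → evalᵇ (faceLiteral (splitAt n i)) S)
  faceLift-stable A⊆Γv S S-stable = Stable-H lifted
    where
    true≢false : true ≢ false
    true≢false ()
    not-both : ∀ b → not b ≡ true → b ≢ true
    not-both true  () _
    not-both false _  ()
    avoid : ∀ ℓ b → S (ι b) ≡ true → S v ≡ true → A ℓ (ι b) ≡ false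
    avoid ℓ b Sb Sv =
      ¬-not λ Aℓb → true≢false (trans (sym (A⊆Γv ℓ (ι b) Aℓb)) (S-stable v (ι b) Sv Sb))
    lifted : ∀ α γ → evalᵇ (faceLiteral α) S ≡ true → evalᵇ (faceLiteral γ) S ≡ true →
             stretchAdj' G v A α γ ≡ false
    lifted (inj₁ b)       (inj₁ c)       Sb  Sc  = S-stable (ι b) (ι c) Sb Sc
    lifted (inj₁ b)       (inj₂ zero)    _   _   = refl
    lifted (inj₁ b)       (inj₂ (suc ℓ)) Sb  Sv  = avoid ℓ b Sb Sv
    lifted (inj₂ zero)    (inj₁ c)       _   _   = refl
    lifted (inj₂ zero)    (inj₂ zero)    _   _   = refl
    lifted (inj₂ zero)    (inj₂ (suc ℓ)) ¬Sv Sv  = ⊥-elim (not-both (S v) ¬Sv Sv)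
    lifted (inj₂ (suc ℓ)) (inj₁ c)       Sv  Sc  = avoid ℓ c Sc Sv
    lifted (inj₂ (suc ℓ)) (inj₂ zero)    Sv  ¬Sv = ⊥-elim (not-both (S v) ¬Sv Sv)
    lifted (inj₂ (suc ℓ)) (inj₂ (suc j)) _   _   = refl

  faceLift-tight : ∀ a β d x → dot a x ≡ β →
                   dot (liftCoef a v d) (onH (faceLift x)) ≡ liftRhs a β v d
  faceLift-tight a β d x ax≡β = begin
    dot (liftCoef a v d) (onH (faceLift x))
      ≡⟨ dot-liftCoef a d (faceLift x) ⟩
    Σ-old + ((sumF d - a v) * (1ℚ - x v) + sumF (λ ℓ → d ℓ * x v))
      ≡⟨ cong (λ s → Σ-old + ((sumF d - a v) * (1ℚ - x v) + s)) (*-distribʳ-sumF (x v) d) ⟩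
    Σ-old + ((sumF d - a v) * (1ℚ - x v) + sumF d * x v)
      ≡⟨ rearrange Σ-old (a v) (x v) (sumF d) ⟩
    (a v * x v + Σ-old) - a v + sumF d
      ≡⟨ cong (λ s → s - a v + sumF d) (trans (sym (dot-punchIn a x)) ax≡β) ⟩
    β - a v + sumF d
      ∎
    where
    Σ-old : ℚ
    Σ-old = sumF (λ b → a (ι b) * x (ι b))
    rearrange : ∀ s a x D → s + ((D - a) * (1ℚ - x) + D * x) ≡ (a * x + s) - a + D
    rearrange = solve-∀ ℚ-ring

  Covered : Fin p → Fin (suc n) → Set
  Covered ℓ u = ∃ λ j → j ≢ ℓ × A j u ≡ true

  covered? : ∀ ℓ u → Dec (Covered ℓ u)
  covered? ℓ u = any? (λ j → ¬? (j ≟ ℓ) ×-dec (A j u Bool.≟ true))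

  -- Covered vertices are deleted from every stable set; this does not move a point of
  -- RestrictedSTAB G v A ℓ, which vanishes there (restrictedLift-old).
  unlessCovered : Fin p → Fin (suc n) → Literal (suc n)
  unlessCovered ℓ u = if does (covered? ℓ u) then const false else pos u

  restrictedLiteral : Fin p → Vertex → Literal (suc n)
  restrictedLiteral ℓ (inj₁ b)       = unlessCovered ℓ (ι b)
  restrictedLiteral ℓ (inj₂ zero)    = const false
  restrictedLiteral ℓ (inj₂ (suc j)) = const (not (does (j ≟ ℓ)))

  restrictedLift : Fin p → Pt (suc n) → Vertex → ℚ
  restrictedLift ℓ x α = evalℚ (restrictedLiteral ℓ α) x

  restrictedLift-stable : ∀ ℓ S → Stable G S →
                          Stable H (λ i → evalᵇ (restrictedLiteral ℓ (splitAt n i)) S)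
  restrictedLift-stable ℓ S S-stable = Stable-H lifted
    where
    uncovered : ∀ {u} → evalᵇ (unlessCovered ℓ u) S ≡ true → ¬ Covered ℓ u × S u ≡ true
    uncovered {u} Su with covered? ℓ u
    ... | no ¬covered = ¬covered , Su
    other-arm : ∀ {j} → not (does (j ≟ ℓ)) ≡ true → j ≢ ℓ
    other-arm {j} _ with j ≟ ℓ
    ... | no j≢ℓ = j≢ℓ
    avoid : ∀ j b → evalᵇ (unlessCovered ℓ (ι b)) S ≡ true → not (does (j ≟ ℓ)) ≡ true →
            A j (ι b) ≡ false
    avoid j b Sb j≢ℓ = ¬-not λ Ajb → proj₁ (uncovered Sb) (j , other-arm j≢ℓ , Ajb)
    lifted : ∀ α γ → evalᵇ (restrictedLiteral ℓ α) S ≡ true →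
             evalᵇ (restrictedLiteral ℓ γ) S ≡ true → stretchAdj' G v A α γ ≡ false
    lifted (inj₁ b)       (inj₁ c)       Sb  Sc  =
      S-stable (ι b) (ι c) (proj₂ (uncovered Sb)) (proj₂ (uncovered Sc))
    lifted (inj₁ b)       (inj₂ zero)    _   _   = refl
    lifted (inj₁ b)       (inj₂ (suc j)) Sb  j≢ℓ = avoid j b Sb j≢ℓ
    lifted (inj₂ zero)    _              ()  _
    lifted (inj₂ (suc j)) (inj₁ c)       j≢ℓ Sc  = avoid j c Sc j≢ℓ
    lifted (inj₂ (suc j)) (inj₂ zero)    _   ()
    lifted (inj₂ (suc j)) (inj₂ (suc _)) _   _   = refl

  restrictedLift-old : ∀ {ℓ x} → (∀ j → j ≢ ℓ → ∀ u → A j u ≡ true → x u ≡ 0ℚ) →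
                       ∀ b → restrictedLift ℓ x (inj₁ b) ≡ x (ι b)
  restrictedLift-old {ℓ} x≡0 b with covered? ℓ (ι b)
  ... | yes (j , j≢ℓ , Ajb) = sym (x≡0 j j≢ℓ (ι b) Ajb)
  ... | no _                = refl

  restrictedLift-tight : ∀ a β m ℓ x → RestrictedSTAB G v A ℓ x → dot a x ≡ m ℓ →
                         dot (liftCoef a v (dCoef a β v m)) (onH (restrictedLift ℓ x)) ≡
                         liftRhs a β v (dCoef a β v m)
  restrictedLift-tight a β m ℓ x (_ , xᵥ≡0 , x≡0) ax≡m = begin
    dot (liftCoef a v d) (onH (restrictedLift ℓ x))
      ≡⟨ dot-liftCoef a d (restrictedLift ℓ x) ⟩
    sumF (λ b → a (ι b) * restrictedLift ℓ x (inj₁ b)) + ((D - a v) * 0ℚ + others)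
      ≡⟨ cong₂ (λ s t → s + ((D - a v) * 0ℚ + t)) old (sumF-allBut d ℓ) ⟩
    Σ-old + ((D - a v) * 0ℚ + (D - d ℓ))
      ≡⟨ rearrange Σ-old (a v) D β (m ℓ) ⟩
    (a v * 0ℚ + Σ-old) - m ℓ + β - a v + D
      ≡⟨ cong (λ s → s - m ℓ + β - a v + D) Σ-old≡m ⟩
    m ℓ - m ℓ + β - a v + D
      ≡⟨ cancel (m ℓ) β (a v) D ⟩
    β - a v + D
      ∎
    where
    d : Fin p → ℚ
    d = dCoef a β v m
    D Σ-old others : ℚ
    D      = sumF d
    Σ-old  = sumF (λ b → a (ι b) * x (ι b))
    others = sumF (λ j → d j * bit (not (does (j ≟ ℓ))))
    old : sumF (λ b → a (ι b) * restrictedLift ℓ x (inj₁ b)) ≡ Σ-old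
    old = sumF-cong (λ b → cong (a (ι b) *_) (restrictedLift-old x≡0 b))
    Σ-old≡m : a v * 0ℚ + Σ-old ≡ m ℓ
    Σ-old≡m = trans (cong (λ t → a v * t + Σ-old) (sym xᵥ≡0)) (trans (sym (dot-punchIn a x)) ax≡m)
    rearrange : ∀ s a D β mℓ →
                s + ((D - a) * 0ℚ + (D - (a - β + mℓ))) ≡ (a * 0ℚ + s) - mℓ + β - a + D
    rearrange = solve-∀ ℚ-ring
    cancel : ∀ mℓ β a D → mℓ - mℓ + β - a + D ≡ β - a + D
    cancel = solve-∀ ℚ-ring

  lincomb-hub : ∀ {k} (c : Fin k → ℚ) (X : Fin k → Pt (suc n)) →
                lincomb c (faceLift ∘ X) (inj₂ zero) ≡ sumF c - lincomb c X v
  lincomb-hub c X =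
    trans (sumF-cong (λ s → distrib (c s) (X s v))) (sumF-distrib-- c (λ s → c s * X s v))
    where
    distrib : ∀ c x → c * (1ℚ - x) ≡ c - c * x
    distrib = solve-∀ ℚ-ring

  faceLift-AffInd : ∀ {k} {X : Fin k → Pt (suc n)} → AffInd X → AffInd (λ s → onH (faceLift (X s)))
  faceLift-AffInd {X = X} X-aff c Σc≡0 c-coord = X-aff c Σc≡0 (∀-punchIn v coordᵥ (c-lifted ∘ inj₁))
    where
    c-lifted : ∀ α → lincomb c (faceLift ∘ X) α ≡ 0ℚ
    c-lifted = ∀-Vertex c-coord
    coordᵥ : lincomb c X v ≡ 0ℚ
    coordᵥ = begin
      lincomb c X v
        ≡⟨ x≡y-[y-x] (lincomb c X v) (sumF c) ⟩
      sumF c - (sumF c - lincomb c X v)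
        ≡⟨ cong₂ _-_ Σc≡0 (trans (sym (lincomb-hub c X)) (c-lifted (inj₂ zero))) ⟩
      0ℚ - 0ℚ
        ≡⟨⟩
      0ℚ
        ∎

  restrictedPart≡0 : ∀ {k} (X : Fin k → Pt (suc n)) (Y : Fin p → Pt (suc n)) c e →
                     sumF c + sumF e ≡ 0ℚ →
                     (∀ i → lincomb c (λ s → onH (faceLift (X s))) i +
                            lincomb e (λ ℓ → onH (restrictedLift ℓ (Y ℓ))) i ≡ 0ℚ) →
                     ∀ ℓ → e ℓ ≡ 0ℚ
  restrictedPart≡0 X Y c e Σ≡0 coord j = begin
    e j
      ≡⟨ solve-e (sumF c) (sumF e) T (e j) ⟩
    (sumF c + sumF e) - ((sumF c - T) + 0ℚ) - (T + (sumF e - e j))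
      ≡⟨ cong₂ _-_ (cong₂ _-_ Σ≡0 hub) arm ⟩
    0ℚ - 0ℚ - 0ℚ
      ≡⟨⟩
    0ℚ
      ∎
    where
    T : ℚ
    T = lincomb c X v
    coord′ : ∀ α → lincomb c (faceLift ∘ X) α +
                   lincomb e (λ ℓ → restrictedLift ℓ (Y ℓ)) α ≡ 0ℚ
    coord′ = ∀-Vertex coord
    hub : (sumF c - T) + 0ℚ ≡ 0ℚ
    hub = trans (cong₂ _+_ (sym (lincomb-hub c X)) (sym (sumF-zero (λ ℓ → *-zeroʳ (e ℓ)))))
                (coord′ (inj₂ zero))
    others : sumF (λ ℓ → e ℓ * bit (not (does (j ≟ ℓ)))) ≡ sumF e - e j
    others = trans (sumF-cong (λ ℓ → cong (λ b → e ℓ * bit (not b)) (does-≟-comm j ℓ)))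
                   (sumF-allBut e j)
    arm : T + (sumF e - e j) ≡ 0ℚ
    arm = trans (cong (T +_) (sym others)) (coord′ (inj₂ (suc j)))
    solve-e : ∀ C E T eⱼ → eⱼ ≡ (C + E) - ((C - T) + 0ℚ) - (T + (E - eⱼ))
    solve-e = solve-∀ ℚ-ring

  liftedFace-AffIndIn : ∀ a β m → (∀ ℓ u → A ℓ u ≡ true → G v u ≡ true) →
    AffIndIn (Face G a β) (suc n) →
    (∀ ℓ → Σ (Pt (suc n)) λ x → RestrictedSTAB G v A ℓ x × dot a x ≡ m ℓ) →
    AffIndIn (Face H (liftCoef a v (dCoef a β v m)) (liftRhs a β v (dCoef a β v m))) (suc n ℕ.+ p)
  liftedFace-AffIndIn a β m A⊆Γv (X , X∈face , X-aff) maximiser = Q , Q∈face , Q-aff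
    where
    d : Fin p → ℚ
    d = dCoef a β v m
    Y : Fin p → Pt (suc n)
    Y ℓ = proj₁ (maximiser ℓ)
    X̂ : Fin (suc n) → Pt (n ℕ.+ suc p)
    X̂ s = onH (faceLift (X s))
    Ŷ : Fin p → Pt (n ℕ.+ suc p)
    Ŷ ℓ = onH (restrictedLift ℓ (Y ℓ))
    Q : Fin (suc n ℕ.+ p) → Pt (n ℕ.+ suc p)
    Q = X̂ ++ Ŷ
    Q′∈face : ∀ σ → Face H (liftCoef a v d) (liftRhs a β v d) ([ X̂ , Ŷ ] σ)
    Q′∈face (inj₁ s) =
      InSTAB-subst (faceLiteral ∘ splitAt n) (faceLift-stable A⊆Γv) (proj₁ (X∈face s)) ,
      faceLift-tight a β d (X s) (proj₂ (X∈face s))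
    Q′∈face (inj₂ ℓ) with Yℓ∈R , aYℓ≡m ← proj₂ (maximiser ℓ) =
      InSTAB-subst (restrictedLiteral ℓ ∘ splitAt n) (restrictedLift-stable ℓ) (proj₁ Yℓ∈R) ,
      restrictedLift-tight a β m ℓ (Y ℓ) Yℓ∈R aYℓ≡m
    Q∈face : ∀ t → Face H (liftCoef a v d) (liftRhs a β v d) (Q t)
    Q∈face t = Q′∈face (splitAt (suc n) t)
    Q-aff : AffInd Q
    Q-aff = AffInd-++ (faceLift-AffInd {X = X} X-aff) (restrictedPart≡0 X Y)

proposition13 : (n p : ℕ) (G : Adj (suc n)) → IsGraph G →
    (v : Fin (suc n)) → 2 ≤ p →
    (A : Fin p → Fin (suc n) → Bool) → IsStretchFamily G v A →
    (a : Pt (suc n)) (β : ℚ) → (∀ i → 0ℚ Q.≤ a i) → Facet G a β →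
    (m : Fin p → ℚ) → (∀ ℓ → IsMax (RestrictedSTAB G v A ℓ) (dot a) (m ℓ)) →
    Valid (stretch G v A) (liftCoef a v (dCoef a β v m)) (liftRhs a β v (dCoef a β v m)) →
    Facet (stretch G v A) (liftCoef a v (dCoef a β v m)) (liftRhs a β v (dCoef a β v m))
proposition13 n p G (_ , G-loopless) v _ A (A⊆Γv , _) a β _ (_ , d , dimG , dimF) m isMax valid =
  valid , n ℕ.+ p , dimH , face-points , ¬more-face-points
  where
  open Stretching G v A
  coefH : Pt (n ℕ.+ suc p)
  coefH = liftCoef a v (dCoef a β v m)
  rhsH : ℚ
  rhsH = liftRhs a β v (dCoef a β v m)
  d≡n : d ≡ n
  d≡n = suc-injective (HasDim-unique {S = InSTAB G} dimG (STAB-fullDim G-loopless))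
  dimH : HasDim (InSTAB H) (suc (n ℕ.+ p))
  dimH = subst (HasDim (InSTAB H)) (+-suc n p) (STAB-fullDim (H-loopless G-loopless))
  face-points : AffIndIn (Face H coefH rhsH) (suc (n ℕ.+ p))
  face-points = liftedFace-AffIndIn a β m (proj₁ ∘ A⊆Γv)
    (subst (λ d → AffIndIn (Face G a β) (suc d)) d≡n (proj₁ dimF)) (proj₁ ∘ isMax)
  coefH≢0 : ¬ (∀ i → coefH i ≡ 0ℚ)
  coefH≢0 = lowerDimFace⇒normal≢0 {S = InSTAB G} dimG dimF ∘ liftCoef≡0 a (dCoef a β v m)
  ¬more-face-points : ¬ AffIndIn (Face H coefH rhsH) (suc (suc (n ℕ.+ p)))
  ¬more-face-points (P , P∈face , P-aff) = 1+n≰n (subst (suc (suc (n ℕ.+ p)) ≤_) (+-suc n p)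
    (AffInd-hyperplane⇒≤ {P = P} coefH≢0 (proj₂ ∘ P∈face) P-aff))
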